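{- For all positive integers $n$ and $r$, $$r^{n-1}=\sum \binom{n}{k_0,\dots,k_{r-1}},$$ where the sum is over all sequences $(k_0,\dots,k_{r-1})$ of non-negative integers of length $r$ such that $\sum_{i=0}^{r-1}k_i=n$ and $r$ divides $\sum_{i=0}^{r-1} i\,k_i$.
   Context: $\binom{n}{k_0,\dots,k_{r-1}}=\frac{n!}{k_0!\cdots k_{r-1}!}$ denotes the multinomial coefficient. -}

module Defs where

open import Data.Nat using (ℕ; zero; suc; _+_; _*_; _∸_; NonZero)
open import Data.Nat.Properties using (_!≢0; m*n≢0)
open import Data.Nat.Combinatorics using ()
open import Data.Nat.Base using (_!)
open import Data.Nat.DivMod using (_/_)
open import Data.Nat.Divisibility using (_∣_; _∣?_)
open import Data.List using (List; []; _∷_; map; concatMap; filter; upTo)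
import Data.List as L
open import Data.Nat.ListAction using () renaming (sum to lsum)
open import Data.Vec using (Vec; []; _∷_; foldr; zip; allFin; toList)
import Data.Vec as V
open import Data.Fin using (Fin; toℕ)

prodFact : ∀ {r} → Vec ℕ r → ℕ
prodFact [] = 1
prodFact (k ∷ ks) = k ! * prodFact ks

prodFact≢0 : ∀ {r} (ks : Vec ℕ r) → NonZero (prodFact ks)
prodFact≢0 [] = _
prodFact≢0 (k ∷ ks) = m*n≢0 (k !) (prodFact ks) {{k !≢0}} {{prodFact≢0 ks}}

multinomial : ∀ {r} → ℕ → Vec ℕ r → ℕ
multinomial n ks = _/_ (n !) (prodFact ks) {{prodFact≢0 ks}}

vsum : ∀ {r} → Vec ℕ r → ℕ
vsum = V.sum

weightedSum : ∀ {r} → Vec ℕ r → ℕ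
weightedSum {r} ks = V.sum (V.zipWith (λ i k → toℕ i * k) (allFin r) ks)

boundedSeqs : (r n : ℕ) → List (Vec ℕ r)
boundedSeqs zero n = [] ∷ []
boundedSeqs (suc r) n =
  concatMap (λ k → map (k ∷_) (boundedSeqs r n)) (upTo (suc n))

-- all sequences (k₀,…,k_{r-1}) of non-negative integers with Σ kᵢ = n
-- (any such sequence has all kᵢ ≤ n), each listed exactly once
compositions : (r n : ℕ) → List (Vec ℕ r)
compositions r n = filter (λ ks → vsum ks Data.Nat.≟ n) (boundedSeqs r n)

admissible : (r n : ℕ) → List (Vec ℕ r)
admissible r n = filter (λ ks → r ∣? weightedSum ks) (compositions r n)

multinomialSum : (r n : ℕ) → ℕ
multinomialSum r n = lsum (map (multinomial n) (admissible r n))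

-- Let (D_r φ) x = φ x + φ (x + 1) + ⋯ + φ (x + r - 1). Both the sum of
-- multinomial(n; k) · φ (Σ i kᵢ) over the compositions k of n into r parts and
-- (D_rⁿ φ) 0 add up φ (letter sum) over the words of length n in {0, …, r - 1}.
-- They agree by induction on r: splitting off k₀ contributes a binomial
-- coefficient, and D_{r+1} ψ x = ψ x + D_r ψ (x + 1), whose n-th power expands
-- by Pascal's rule. For φ the indicator of r ∣ _, every window of r consecutive
-- integers contains exactly one multiple of r, so D_r φ = 1 and
-- (D_rⁿ φ) 0 = (D_rⁿ⁻¹ 1) 0 = r ^ (n - 1).
module Submission where

open import Defs
open import Data.Nat using (ℕ; _^_; _∸_; NonZero)
open import Relation.Binary.PropositionalEquality using (_≡_)
open import Level using (Level)
open import Data.Bool using (true; false; if_then_else_)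
open import Data.Nat.Base
open import Data.Nat.Properties
open import Data.Nat.Combinatorics
open import Data.Nat.Divisibility
open import Data.Nat.DivMod using (m/n*n≡m)
open import Data.Nat.GeneralisedArithmetic using (fold; iterate-is-fold)
open import Data.Nat.ListAction using (sum)
open import Data.Nat.ListAction.Properties using (sum-++)
open import Data.Nat.Tactic.RingSolver using (solve-∀)
open import Data.List using (List; []; _∷_; _++_; map; filter; concatMap; applyUpTo; upTo)
open import Data.List.Properties using (map-++; map-cong; map-∘)
open import Data.Vec as V using (Vec; []; _∷_)
open import Data.Fin as Fin using (Fin; toℕ)
open import Function using (_∘_)
open import Relation.Nullary using (Dec; does; yes; no; ¬_; contradiction)
open import Relation.Unary using (Pred; Decidable)
open import Relation.Binary.PropositionalEquality
  using (_≢_; refl; sym; trans; cong; cong₂; subst; _≗_; module ≡-Reasoning)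
open ≡-Reasoning

private
  variable
    ℓ ℓ′ : Level
    A : Set ℓ
    B : Set ℓ′

∑< : ℕ → (ℕ → ℕ) → ℕ
∑< zero    f = 0
∑< (suc m) f = f 0 + ∑< m (λ i → f (suc i))

-- The body of a sum extends over _*_ but not over _+_.
infixr 6.5 ∑<
syntax ∑< m (λ i → e) = ∑[ i < m ] e

∑-cong-< : ∀ m {f g : ℕ → ℕ} → (∀ i → i < m → f i ≡ g i) → ∑< m f ≡ ∑< m g
∑-cong-< zero    eq = refl
∑-cong-< (suc m) eq = cong₂ _+_ (eq 0 z<s) (∑-cong-< m (λ i i<m → eq (suc i) (s<s i<m)))

∑-cong : ∀ m {f g : ℕ → ℕ} → f ≗ g → ∑< m f ≡ ∑< m g
∑-cong m eq = ∑-cong-< m (λ i _ → eq i)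

∑-zero : ∀ m {f : ℕ → ℕ} → (∀ i → i < m → f i ≡ 0) → ∑< m f ≡ 0
∑-zero zero    eq = refl
∑-zero (suc m) eq = cong₂ _+_ (eq 0 z<s) (∑-zero m (λ i i<m → eq (suc i) (s<s i<m)))

∑-const : ∀ m c → ∑< m (λ _ → c) ≡ m * c
∑-const zero    c = refl
∑-const (suc m) c = cong (c +_) (∑-const m c)

∑-snoc : ∀ m f → ∑< (suc m) f ≡ ∑< m f + f m
∑-snoc zero    f = +-identityʳ (f 0)
∑-snoc (suc m) f = trans (cong (f 0 +_) (∑-snoc m (f ∘ suc))) (sym (+-assoc (f 0) _ _))

∑-+ : ∀ m n f → ∑< (m + n) f ≡ ∑< m f + ∑[ i < n ] f (m + i)
∑-+ zero    n f = refl
∑-+ (suc m) n f = trans (cong (f 0 +_) (∑-+ m n (f ∘ suc))) (sym (+-assoc (f 0) _ _))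

∑-truncate : ∀ m n {f} → (∀ i → f (m + i) ≡ 0) → ∑< (m + n) f ≡ ∑< m f
∑-truncate m n {f} eq = begin
  ∑< (m + n) f                     ≡⟨ ∑-+ m n f ⟩
  ∑< m f + ∑[ i < n ] f (m + i)    ≡⟨ cong (∑< m f +_) (∑-zero n (λ i _ → eq i)) ⟩
  ∑< m f + 0                       ≡⟨ +-identityʳ _ ⟩
  ∑< m f                           ∎

∑-distrib-+ : ∀ m f g → ∑[ i < m ] (f i + g i) ≡ ∑< m f + ∑< m g
∑-distrib-+ zero    f g = refl
∑-distrib-+ (suc m) f g =
  trans (cong (f 0 + g 0 +_) (∑-distrib-+ m (f ∘ suc) (g ∘ suc)))
        (+-interchange (f 0) (g 0) _ _)
  where
  +-interchange : ∀ a b c d → (a + b) + (c + d) ≡ (a + c) + (b + d)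
  +-interchange = solve-∀

*-distribˡ-∑ : ∀ m c f → ∑[ i < m ] (c * f i) ≡ c * ∑< m f
*-distribˡ-∑ zero    c f = sym (*-zeroʳ c)
*-distribˡ-∑ (suc m) c f =
  trans (cong (c * f 0 +_) (*-distribˡ-∑ m c (f ∘ suc))) (sym (*-distribˡ-+ c (f 0) _))

∑-comm : ∀ m n (f : ℕ → ℕ → ℕ) →
  ∑[ i < m ] ∑[ j < n ] f i j ≡ ∑[ j < n ] ∑[ i < m ] f i j
∑-comm zero    n f = sym (∑-zero n (λ _ _ → refl))
∑-comm (suc m) n f =
  trans (cong (∑[ j < n ] f 0 j +_) (∑-comm m n (f ∘ suc)))
        (sym (∑-distrib-+ n (f 0) (λ j → ∑[ i < m ] f (suc i) j)))

∑-reverse : ∀ n f → ∑< (suc n) f ≡ ∑[ k < suc n ] f (n ∸ k)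
∑-reverse zero    f = refl
∑-reverse (suc n) f = begin
  ∑< (suc (suc n)) f                    ≡⟨ ∑-snoc (suc n) f ⟩
  ∑< (suc n) f + f (suc n)              ≡⟨ cong (_+ f (suc n)) (∑-reverse n f) ⟩
  ∑[ k < suc n ] f (n ∸ k) + f (suc n)  ≡⟨ +-comm _ (f (suc n)) ⟩
  f (suc n) + ∑[ k < suc n ] f (n ∸ k)  ∎

∑-pascal : ∀ n (a : ℕ → ℕ) →
  ∑[ j < suc n ] (n C j) * a j + ∑[ j < suc n ] (n C j) * a (suc j) ≡
  ∑[ j < suc (suc n) ] (suc n C j) * a j
∑-pascal n a = begin
  (1 * a 0 + ∑[ j < n ] (n C suc j) * a (suc j)) + L
    ≡⟨ cong (λ s → (1 * a 0 + s) + L) drop-last ⟩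
  (1 * a 0 + R) + L
    ≡⟨ +-shuffle (1 * a 0) R L ⟩
  1 * a 0 + (L + R)
    ≡⟨ cong (1 * a 0 +_) (∑-distrib-+ (suc n) (λ j → (n C j) * a (suc j))
                                              (λ j → (n C suc j) * a (suc j))) ⟨
  1 * a 0 + ∑[ j < suc n ] ((n C j) * a (suc j) + (n C suc j) * a (suc j))
    ≡⟨ cong (1 * a 0 +_) (∑-cong (suc n) pascal) ⟩
  1 * a 0 + ∑[ j < suc n ] (suc n C suc j) * a (suc j)
    ∎
  where
  L R : ℕ
  L = ∑[ j < suc n ] (n C j) * a (suc j)
  R = ∑[ j < suc n ] (n C suc j) * a (suc j)
  drop-last : ∑[ j < n ] (n C suc j) * a (suc j) ≡ R
  drop-last = sym (begin
    R
      ≡⟨ ∑-snoc n (λ j → (n C suc j) * a (suc j)) ⟩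
    ∑[ j < n ] (n C suc j) * a (suc j) + (n C suc n) * a (suc n)
      ≡⟨ cong (λ c → ∑[ j < n ] (n C suc j) * a (suc j) + c * a (suc n))
              (k>n⇒nCk≡0 (n<1+n n)) ⟩
    ∑[ j < n ] (n C suc j) * a (suc j) + 0
      ≡⟨ +-identityʳ _ ⟩
    ∑[ j < n ] (n C suc j) * a (suc j)
      ∎)
  pascal : ∀ j → (n C j) * a (suc j) + (n C suc j) * a (suc j) ≡ (suc n C suc j) * a (suc j)
  pascal j = trans (sym (*-distribʳ-+ (a (suc j)) (n C j) (n C suc j)))
                   (cong (_* a (suc j)) (nCk+nC[k+1]≡[n+1]C[k+1] n j))
  +-shuffle : ∀ x y z → (x + y) + z ≡ x + (z + y)
  +-shuffle = solve-∀

𝟙 : Dec A → ℕ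
𝟙 d = if does d then 1 else 0

𝟙-yes : (d : Dec A) → A → 𝟙 d ≡ 1
𝟙-yes (yes _) _ = refl
𝟙-yes (no ¬a) a = contradiction a ¬a

𝟙-no : (d : Dec A) → ¬ A → 𝟙 d ≡ 0
𝟙-no (yes a) ¬a = contradiction a ¬a
𝟙-no (no _)  _  = refl

𝟙-cong : (d : Dec A) (e : Dec B) → (A → B) → (B → A) → 𝟙 d ≡ 𝟙 e
𝟙-cong (yes a) e to from = sym (𝟙-yes e (to a))
𝟙-cong (no ¬a) e to from = sym (𝟙-no e (¬a ∘ from))

𝟙*-cong : (d : Dec A) {x y : ℕ} → (A → x ≡ y) → 𝟙 d * x ≡ 𝟙 d * y
𝟙*-cong (yes a) eq = cong (1 *_) (eq a)
𝟙*-cong (no _)  eq = refl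

sum-map-filter : ∀ {p} {P : Pred A p} (P? : Decidable P) (f : A → ℕ) xs →
  sum (map f (filter P? xs)) ≡ sum (map (λ x → 𝟙 (P? x) * f x) xs)
sum-map-filter P? f []       = refl
sum-map-filter P? f (x ∷ xs) with does (P? x)
... | true  = cong₂ _+_ (sym (*-identityˡ (f x))) (sum-map-filter P? f xs)
... | false = sum-map-filter P? f xs

sum-map-*ˡ : ∀ c (f : A → ℕ) xs → sum (map (λ x → c * f x) xs) ≡ c * sum (map f xs)
sum-map-*ˡ c f []       = sym (*-zeroʳ c)
sum-map-*ˡ c f (x ∷ xs) =
  trans (cong (c * f x +_) (sum-map-*ˡ c f xs)) (sym (*-distribˡ-+ c (f x) _))

sum-map-concatMap : ∀ (f : B → ℕ) (g : A → List B) xs →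
  sum (map f (concatMap g xs)) ≡ sum (map (λ x → sum (map f (g x))) xs)
sum-map-concatMap f g []       = refl
sum-map-concatMap f g (x ∷ xs) = begin
  sum (map f (g x ++ concatMap g xs))
    ≡⟨ cong sum (map-++ f (g x) (concatMap g xs)) ⟩
  sum (map f (g x) ++ map f (concatMap g xs))
    ≡⟨ sum-++ (map f (g x)) (map f (concatMap g xs)) ⟩
  sum (map f (g x)) + sum (map f (concatMap g xs))
    ≡⟨ cong (sum (map f (g x)) +_) (sum-map-concatMap f g xs) ⟩
  sum (map f (g x)) + sum (map (λ x → sum (map f (g x))) xs)
    ∎

sum-map-applyUpTo : ∀ (f : ℕ → ℕ) g m → sum (map f (applyUpTo g m)) ≡ ∑[ i < m ] f (g i)
sum-map-applyUpTo f g zero    = refl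
sum-map-applyUpTo f g (suc m) = cong (f (g 0) +_) (sum-map-applyUpTo f (g ∘ suc) m)

prodFact∣vsum! : ∀ {r} (ks : Vec ℕ r) → prodFact ks ∣ vsum ks !
prodFact∣vsum! []       = ∣-refl
prodFact∣vsum! (k ∷ ks) = ∣-trans (*-monoʳ-∣ (k !) (prodFact∣vsum! ks))
  (subst (λ m → k ! * m ! ∣ (k + vsum ks) !) (m+n∸m≡n k (vsum ks))
         (k![n∸k]!∣n! (m≤m+n k (vsum ks))))

multinomial*prodFact : ∀ {r n} (ks : Vec ℕ r) → vsum ks ≡ n →
  multinomial n ks * prodFact ks ≡ n !
multinomial*prodFact ks refl = m/n*n≡m {{prodFact≢0 ks}} (prodFact∣vsum! ks)

nCk*k!*[n∸k]!≡n! : ∀ {n k} → k ≤ n → (n C k) * (k ! * (n ∸ k) !) ≡ n !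
nCk*k!*[n∸k]!≡n! {n} {k} k≤n =
  trans (cong (_* (k ! * (n ∸ k) !)) (nCk≡n!/k![n-k]! k≤n))
        (m/n*n≡m {{k !* (n ∸ k) !≢0}} (k![n∸k]!∣n! k≤n))

multinomial-∷ : ∀ {r n k} (ks : Vec ℕ r) → k ≤ n → vsum ks ≡ n ∸ k →
  multinomial n (k ∷ ks) ≡ (n C k) * multinomial (n ∸ k) ks
multinomial-∷ {n = n} {k} ks k≤n eq =
  *-cancelʳ-≡ _ _ (prodFact (k ∷ ks)) {{prodFact≢0 (k ∷ ks)}} (begin
    multinomial n (k ∷ ks) * prodFact (k ∷ ks)
      ≡⟨ multinomial*prodFact (k ∷ ks) (trans (cong (k +_) eq) (m+[n∸m]≡n k≤n)) ⟩
    n !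
      ≡⟨ nCk*k!*[n∸k]!≡n! k≤n ⟨
    (n C k) * (k ! * (n ∸ k) !)
      ≡⟨ cong (λ m → (n C k) * (k ! * m)) (multinomial*prodFact ks eq) ⟨
    (n C k) * (k ! * (multinomial (n ∸ k) ks * prodFact ks))
      ≡⟨ rearrange (n C k) (k !) (multinomial (n ∸ k) ks) (prodFact ks) ⟩
    (n C k) * multinomial (n ∸ k) ks * prodFact (k ∷ ks)
      ∎)
  where
  rearrange : ∀ c f m p → c * (f * (m * p)) ≡ c * m * (f * p)
  rearrange = solve-∀

-- weightedSum ks is weightedSumBy (λ i → i) ks; the general index map is what
-- makes the induction go through.
weightedSumBy : ∀ {r m} → (Fin r → Fin m) → Vec ℕ r → ℕ
weightedSumBy g ks = V.sum (V.zipWith (λ i k → toℕ i * k) (V.tabulate g) ks)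

weightedSumBy-suc : ∀ {r m} (g : Fin r → Fin m) (ks : Vec ℕ r) →
  weightedSumBy (Fin.suc ∘ g) ks ≡ weightedSumBy g ks + vsum ks
weightedSumBy-suc g []       = refl
weightedSumBy-suc g (k ∷ ks) =
  trans (cong ((k + toℕ (g Fin.zero) * k) +_) (weightedSumBy-suc (g ∘ Fin.suc) ks))
        (shuffle k (toℕ (g Fin.zero) * k) _ (vsum ks))
  where
  shuffle : ∀ k a s v → (k + a) + (s + v) ≡ (a + s) + (k + v)
  shuffle = solve-∀

weightedSum-∷ : ∀ {r} k (ks : Vec ℕ r) → weightedSum (k ∷ ks) ≡ weightedSum ks + vsum ks
weightedSum-∷ k ks = weightedSumBy-suc (λ i → i) ks

shift : ℕ → (ℕ → ℕ) → ℕ → ℕ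
shift c φ y = φ (y + c)

D : ℕ → (ℕ → ℕ) → ℕ → ℕ
D r φ x = ∑[ i < r ] φ (x + i)

D^ : ℕ → ℕ → (ℕ → ℕ) → ℕ → ℕ
D^ r n φ = fold φ (D r) n

D-suc : ∀ r ψ x → D (suc r) ψ x ≡ ψ x + D r ψ (suc x)
D-suc r ψ x = cong₂ _+_ (cong ψ (+-identityʳ x)) (∑-cong r (λ i → cong ψ (+-suc x i)))

D-periodic : ∀ r {φ} → (∀ y → φ (y + r) ≡ φ y) → ∀ x → D r φ (suc x) ≡ D r φ x
D-periodic r {φ} periodic x = +-cancelʳ-≡ (φ x) _ _ (begin
  D r φ (suc x) + φ x    ≡⟨ +-comm _ (φ x) ⟩
  φ x + D r φ (suc x)    ≡⟨ D-suc r φ x ⟨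
  D (suc r) φ x          ≡⟨ ∑-snoc r (λ i → φ (x + i)) ⟩
  D r φ x + φ (x + r)    ≡⟨ cong (D r φ x +_) (periodic x) ⟩
  D r φ x + φ x          ∎)

D^-suc : ∀ r n φ → D^ r (suc n) φ ≡ D^ r n (D r φ)
D^-suc r n φ = trans (iterate-is-fold φ (D r) (suc n)) (sym (iterate-is-fold (D r φ) (D r) n))

D^-cong : ∀ r n {φ ψ} → φ ≗ ψ → D^ r n φ ≗ D^ r n ψ
D^-cong r zero    eq   = eq
D^-cong r (suc n) eq x = ∑-cong r (λ i → D^-cong r n eq (x + i))

D^-shift : ∀ r n φ c x → D^ r n (shift c φ) x ≡ D^ r n φ (x + c)
D^-shift r zero    φ c x = refl
D^-shift r (suc n) φ c x =
  ∑-cong r (λ i → trans (D^-shift r n φ c (x + i)) (cong (D^ r n φ) (+-swapʳ x i c)))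
  where
  +-swapʳ : ∀ x i c → x + i + c ≡ x + c + i
  +-swapʳ = solve-∀

D^-const : ∀ r n x → D^ r n (λ _ → 1) x ≡ r ^ n
D^-const r zero    x = refl
D^-const r (suc n) x = trans (∑-cong r (λ i → D^-const r n (x + i))) (∑-const r (r ^ n))

D^-binomial : ∀ r n φ x → D^ (suc r) n φ x ≡ ∑[ j < suc n ] (n C j) * D^ r j φ (x + j)
D^-binomial r zero    φ x =
  sym (trans (+-identityʳ _) (trans (*-identityˡ _) (cong φ (+-identityʳ x))))
D^-binomial r (suc n) φ x = begin
  D (suc r) Ψ x
    ≡⟨ D-suc r Ψ x ⟩
  Ψ x + ∑[ i < r ] Ψ (suc x + i)
    ≡⟨ cong₂ _+_ (D^-binomial r n φ x) (∑-cong r (λ i → D^-binomial r n φ (suc x + i))) ⟩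
  Σ₀ + ∑[ i < r ] ∑[ j < suc n ] (n C j) * u j (suc x + i)
    ≡⟨ cong (Σ₀ +_) (∑-comm r (suc n) (λ i j → (n C j) * u j (suc x + i))) ⟩
  Σ₀ + ∑[ j < suc n ] ∑[ i < r ] (n C j) * u j (suc x + i)
    ≡⟨ cong (Σ₀ +_) (∑-cong (suc n) (λ j →
         trans (*-distribˡ-∑ r (n C j) (λ i → u j (suc x + i))) (cong ((n C j) *_) (D-u j)))) ⟩
  Σ₀ + ∑[ j < suc n ] (n C j) * u (suc j) x
    ≡⟨ ∑-pascal n (λ j → u j x) ⟩
  ∑[ j < suc (suc n) ] (suc n C j) * u j x
    ∎
  where
  Ψ : ℕ → ℕ
  Ψ = D^ (suc r) n φ
  u : ℕ → ℕ → ℕ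
  u j y = D^ r j φ (y + j)
  Σ₀ : ℕ
  Σ₀ = ∑[ j < suc n ] (n C j) * u j x
  reassoc : ∀ x i j → suc x + i + j ≡ x + suc j + i
  reassoc = solve-∀
  D-u : ∀ j → D r (u j) (suc x) ≡ u (suc j) x
  D-u j = ∑-cong r (λ i → cong (D^ r j φ) (reassoc x i j))

𝟙∣ : ℕ → ℕ → ℕ
𝟙∣ r w = 𝟙 (r ∣? w)

𝟙∣-periodic : ∀ r y → 𝟙∣ r (y + r) ≡ 𝟙∣ r y
𝟙∣-periodic r y = 𝟙-cong (r ∣? (y + r)) (r ∣? y)
  (λ r∣y+r → ∣m+n∣m⇒∣n (subst (r ∣_) (+-comm y r) r∣y+r) ∣-refl)
  (λ r∣y → ∣m∣n⇒∣m+n r∣y ∣-refl)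

D-𝟙∣ : ∀ m x → D (suc m) (𝟙∣ (suc m)) x ≡ 1
D-𝟙∣ m zero    = cong₂ _+_ (𝟙-yes (suc m ∣? 0) (suc m ∣0))
  (∑-zero m (λ i i<m → 𝟙-no (suc m ∣? suc i)
    (λ m+1∣i+1 → <⇒≱ (s<s i<m) (∣⇒≤ m+1∣i+1))))
D-𝟙∣ m (suc x) = trans (D-periodic (suc m) (𝟙∣-periodic (suc m)) x) (D-𝟙∣ m x)

compositionTerm : ∀ {r} → ℕ → (ℕ → ℕ) → Vec ℕ r → ℕ
compositionTerm n φ ks = 𝟙 (vsum ks ≟ n) * (multinomial n ks * φ (weightedSum ks))

compositionSum : (r B n : ℕ) → (ℕ → ℕ) → ℕ
compositionSum r B n φ = sum (map (compositionTerm n φ) (boundedSeqs r B))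

compositionTerm-∷ : ∀ {r} n φ k (ks : Vec ℕ r) →
  compositionTerm n φ (k ∷ ks) ≡ (n C k) * compositionTerm (n ∸ k) (shift (n ∸ k) φ) ks
compositionTerm-∷ n φ k ks with k ≤? n
... | no k≰n = begin
  𝟙 (k + vsum ks ≟ n) * X  ≡⟨ cong (_* X) (𝟙-no (k + vsum ks ≟ n) k+vsum≢n) ⟩
  0                        ≡⟨ cong (_* Y) (k>n⇒nCk≡0 (≰⇒> k≰n)) ⟨
  (n C k) * Y              ∎
  where
  X = multinomial n (k ∷ ks) * φ (weightedSum (k ∷ ks))
  Y = compositionTerm (n ∸ k) (shift (n ∸ k) φ) ks
  k+vsum≢n : k + vsum ks ≢ n
  k+vsum≢n eq = k≰n (subst (k ≤_) eq (m≤m+n k (vsum ks)))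
... | yes k≤n = begin
  𝟙 (k + vsum ks ≟ n) * X
    ≡⟨ cong (_* X) (𝟙-cong (k + vsum ks ≟ n) (vsum ks ≟ n ∸ k)
         (λ eq → trans (sym (m+n∸m≡n k (vsum ks))) (cong (_∸ k) eq))
         (λ eq → trans (cong (k +_) eq) (m+[n∸m]≡n k≤n))) ⟩
  𝟙 (vsum ks ≟ n ∸ k) * X
    ≡⟨ 𝟙*-cong (vsum ks ≟ n ∸ k) (λ eq →
         cong₂ _*_ (multinomial-∷ ks k≤n eq)
                   (cong φ (trans (weightedSum-∷ k ks) (cong (weightedSum ks +_) eq)))) ⟩
  𝟙 (vsum ks ≟ n ∸ k) * ((n C k) * multinomial (n ∸ k) ks * φ (weightedSum ks + (n ∸ k)))
    ≡⟨ rearrange (𝟙 (vsum ks ≟ n ∸ k)) (n C k) _ _ ⟩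
  (n C k) * compositionTerm (n ∸ k) (shift (n ∸ k) φ) ks
    ∎
  where
  X = multinomial n (k ∷ ks) * φ (weightedSum (k ∷ ks))
  rearrange : ∀ e c m p → e * (c * m * p) ≡ c * (e * (m * p))
  rearrange = solve-∀

compositionSum-suc : ∀ r B n φ → compositionSum (suc r) B n φ ≡
  ∑[ k < suc B ] (n C k) * compositionSum r B (n ∸ k) (shift (n ∸ k) φ)
compositionSum-suc r B n φ = begin
  sum (map (compositionTerm n φ) (concatMap (λ k → map (k ∷_) seqs) (upTo (suc B))))
    ≡⟨ sum-map-concatMap (compositionTerm n φ) (λ k → map (k ∷_) seqs) (upTo (suc B)) ⟩
  sum (map first (upTo (suc B)))
    ≡⟨ sum-map-applyUpTo first (λ k → k) (suc B) ⟩
  ∑< (suc B) first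
    ≡⟨ ∑-cong (suc B) split-first ⟩
  ∑[ k < suc B ] (n C k) * compositionSum r B (n ∸ k) (shift (n ∸ k) φ)
    ∎
  where
  seqs = boundedSeqs r B
  first : ℕ → ℕ
  first k = sum (map (compositionTerm n φ) (map (k ∷_) seqs))
  split-first : ∀ k → first k ≡ (n C k) * compositionSum r B (n ∸ k) (shift (n ∸ k) φ)
  split-first k = begin
    first k
      ≡⟨ cong sum (map-∘ seqs) ⟨
    sum (map (compositionTerm n φ ∘ (k ∷_)) seqs)
      ≡⟨ cong sum (map-cong (compositionTerm-∷ n φ k) seqs) ⟩
    sum (map (λ ks → (n C k) * compositionTerm (n ∸ k) (shift (n ∸ k) φ) ks) seqs)
      ≡⟨ sum-map-*ˡ (n C k) (compositionTerm (n ∸ k) (shift (n ∸ k) φ)) seqs ⟩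
    (n C k) * compositionSum r B (n ∸ k) (shift (n ∸ k) φ)
      ∎

compositionSum≡D^ : ∀ r {B n} φ → n ≤ B → compositionSum r B n φ ≡ D^ r n φ 0
compositionSum≡D^ zero {n = zero}  φ _ =
  trans (+-identityʳ _) (trans (*-identityˡ _) (*-identityˡ (φ 0)))
compositionSum≡D^ zero {n = suc n} φ _ =
  trans (+-identityʳ _) (cong (_* (multinomial (suc n) [] * φ 0)) (𝟙-no (0 ≟ suc n) (λ ())))
compositionSum≡D^ (suc r) {B} {n} φ n≤B = begin
  compositionSum (suc r) B n φ
    ≡⟨ compositionSum-suc r B n φ ⟩
  ∑[ k < suc B ] (n C k) * compositionSum r B (n ∸ k) (shift (n ∸ k) φ)
    ≡⟨ ∑-cong (suc B) (λ k → cong ((n C k) *_)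
         (compositionSum≡D^ r (shift (n ∸ k) φ) (≤-trans (m∸n≤m n k) n≤B))) ⟩
  ∑< (suc B) g
    ≡⟨ cong (λ b → ∑< (suc b) g) (m+[n∸m]≡n n≤B) ⟨
  ∑< (suc n + (B ∸ n)) g
    ≡⟨ ∑-truncate (suc n) (B ∸ n) {g} (λ i →
         cong (_* G (suc n + i)) (k>n⇒nCk≡0 (s≤s (m≤m+n n i)))) ⟩
  ∑< (suc n) g
    ≡⟨ ∑-reverse n g ⟩
  ∑[ j < suc n ] g (n ∸ j)
    ≡⟨ ∑-cong-< (suc n) (λ j j<1+n → reindex (s≤s⁻¹ j<1+n)) ⟩
  ∑[ j < suc n ] (n C j) * D^ r j φ j
    ≡⟨ D^-binomial r n φ 0 ⟨
  D^ (suc r) n φ 0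
    ∎
  where
  G g : ℕ → ℕ
  G k = D^ r (n ∸ k) (shift (n ∸ k) φ) 0
  g k = (n C k) * G k
  reindex : ∀ {j} → j ≤ n → g (n ∸ j) ≡ (n C j) * D^ r j φ j
  reindex {j} j≤n = cong₂ _*_ (sym (nCk≡nC[n∸k] j≤n))
    (trans (cong (λ c → D^ r c (shift c φ) 0) (m∸[m∸n]≡n j≤n)) (D^-shift r j φ j 0))

multinomialSum≡compositionSum : ∀ r n → multinomialSum r n ≡ compositionSum r n n (𝟙∣ r)
multinomialSum≡compositionSum r n = begin
  multinomialSum r n
    ≡⟨ sum-map-filter (λ ks → r ∣? weightedSum ks) (multinomial n) (compositions r n) ⟩
  sum (map (λ ks → 𝟙 (r ∣? weightedSum ks) * multinomial n ks) (compositions r n))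
    ≡⟨ sum-map-filter (λ ks → vsum ks ≟ n) _ seqs ⟩
  sum (map (λ ks → 𝟙 (vsum ks ≟ n) * (𝟙 (r ∣? weightedSum ks) * multinomial n ks)) seqs)
    ≡⟨ cong sum (map-cong (λ ks →
         cong (𝟙 (vsum ks ≟ n) *_) (*-comm _ (multinomial n ks))) seqs) ⟩
  compositionSum r n n (𝟙∣ r)
    ∎
  where
  seqs = boundedSeqs r n

corollary2p7 : (n r : ℕ) → .{{_ : NonZero n}} → .{{_ : NonZero r}} →
               r ^ (n ∸ 1) ≡ multinomialSum r n
corollary2p7 (suc n) r@(suc m) = sym (begin
  multinomialSum r (suc n)                 ≡⟨ multinomialSum≡compositionSum r (suc n) ⟩
  compositionSum r (suc n) (suc n) (𝟙∣ r)  ≡⟨ compositionSum≡D^ r (𝟙∣ r) ≤-refl ⟩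
  D^ r (suc n) (𝟙∣ r) 0                    ≡⟨ cong (λ f → f 0) (D^-suc r n (𝟙∣ r)) ⟩
  D^ r n (D r (𝟙∣ r)) 0                    ≡⟨ D^-cong r n (D-𝟙∣ m) 0 ⟩
  D^ r n (λ _ → 1) 0                       ≡⟨ D^-const r n 0 ⟩
  r ^ n                                    ∎)
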